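{- For every $i\geq 1$ and every $1\leq j\leq \lceil i/2\rceil$, $$g_{i,j}(q)=\sum_{p\in \mathcal{AP}_{i,j}}q^{\mathrm{ch}(p)-j+1}.$$
   Context: The $q$-Seidel triangle $(g_{i,j}(q))_{i,j\geq 1}$ is the array of polynomials in $q$ defined by $g_{1,1}(q)=g_{2,1}(q)=1$, the convention $g_{i,j}(q)=0$ if $j<0$ or $j>\lceil i/2\rceil$, and for $i\geq 1$: $g_{2i+1,j}(q)=g_{2i+1,j-1}(q)+q^{j-1}g_{2i,j}(q)$ for $j=1,2,\ldots,i+1$ (computed in this order), and $g_{2i,j}(q)=g_{2i,j+1}(q)+q^{j-1}g_{2i-1,j}(q)$ for $j=i,i-1,\ldots,1$ (computed in this order). An alternating pistol on $[m]=\{1,\ldots,m\}$ is a map $p:[m]\to[m]$ such that, for all $i$ for which the arguments lie in $[m]$: $p(2i)\leq i$, $p(2i-1)\leq i$, $p(2i-1)\geq p(2i)$ and $p(2i)\leq p(2i+1)$. The charge of $p$ is $\mathrm{ch}(p)=\sum_{k=1}^m (p(k)-1)$. $\mathcal{AP}_{i,j}$ denotes the set of alternating pistols $p$ on $[i]$ with $p(i)=j$. -}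

module Defs where

open import Data.Nat using (ℕ; zero; suc; _+_; _*_; _∸_; _≤_; ⌈_/2⌉)
open import Data.Nat.Properties using (_≤?_)
open import Data.Bool using (Bool; true; false; if_then_else_)
open import Data.Vec using (Vec; []; _∷_; map; sum)
open import Data.List using (List; foldr)
open import Data.Product using (_×_)
open import Relation.Nullary.Decidable using (⌊_⌋)

-- Polynomials in q with natural-number coefficients, represented by
-- their coefficient sequence: P n = coefficient of q^n.
-- Two polynomials are equal iff all coefficients agree (_≈ₚ_).

Poly : Set
Poly = ℕ → ℕ

0ₚ : Poly
0ₚ _ = 0

1ₚ : Poly
1ₚ zero    = 1
1ₚ (suc _) = 0

_+ₚ_ : Poly → Poly → Poly
(P +ₚ Q) n = P n + Q n

q^_·_ : ℕ → Poly → Poly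
(q^ zero · P) n = P n
(q^ suc k · P) zero = 0
(q^ suc k · P) (suc n) = (q^ k · P) n

q^ : ℕ → Poly
q^ k = q^ k · 1ₚ

_≈ₚ_ : Poly → Poly → Set
P ≈ₚ Q = ∀ n → P n ≡' Q n
  where open import Relation.Binary.PropositionalEquality renaming (_≡_ to _≡'_)

-- The q-Seidel triangle g_{m,j}(q)  (written  g m j ; indices 1-based).

isOdd : ℕ → Bool
isOdd zero = false
isOdd (suc zero) = true
isOdd (suc (suc n)) = isOdd n

-- convention: g_{m,j} = 0 unless 1 ≤ j ≤ ⌈m/2⌉
inRange : ℕ → ℕ → Poly → Poly
inRange m zero    P = 0ₚ
inRange m (suc j) P = if ⌊ suc j ≤? ⌈ m /2⌉ ⌋ then P else 0ₚ

-- odd row 2i+1 from row 2i (prev):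
--   g_{2i+1,0} = 0,  g_{2i+1,j} = g_{2i+1,j-1} + q^{j-1} g_{2i,j}
oddRaw : (ℕ → Poly) → ℕ → Poly
oddRaw prev zero    = 0ₚ
oddRaw prev (suc j) = oddRaw prev j +ₚ (q^ j · prev (suc j))

-- even row 2i from row 2i-1 (prev):  evenRaw prev j k  is g_{2i,j}
-- where k = i+1-j is the number of steps from the boundary g_{2i,i+1} = 0:
--   g_{2i,j} = g_{2i,j+1} + q^{j-1} g_{2i-1,j}
evenRaw : (ℕ → Poly) → ℕ → ℕ → Poly
evenRaw prev j zero    = 0ₚ
evenRaw prev j (suc k) = evenRaw prev (suc j) k +ₚ (q^ (j ∸ 1) · prev j)

nextRow : ℕ → (ℕ → Poly) → ℕ → Poly
nextRow m prev j =
  inRange (suc m) j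
    (if isOdd (suc m)
       then oddRaw prev j
       else evenRaw prev j (suc ⌈ suc m /2⌉ ∸ j))

g : ℕ → ℕ → Poly
g zero j = 0ₚ
g (suc zero) j = inRange 1 j 1ₚ
g (suc (suc m)) j = nextRow (suc m) (g (suc m)) j

-- Alternating pistols.  A map p : [m] → [m] is stored as the vector
-- (p(1), …, p(m)) of natural numbers.

-- 1-based evaluation; returns 0 outside [m] (never used there)
_at_ : {m : ℕ} → Vec ℕ m → ℕ → ℕ
[] at _ = 0
(x ∷ xs) at zero = 0
(x ∷ xs) at suc zero = x
(x ∷ xs) at suc (suc k) = xs at suc k

AlternatingPistol : (m : ℕ) → Vec ℕ m → Set
AlternatingPistol m p =
  (∀ k → 1 ≤ k → k ≤ m → (1 ≤ p at k) × (p at k ≤ m)) ×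
  (∀ i → 1 ≤ i → 2 * i ≤ m → p at (2 * i) ≤ i) ×
  (∀ i → 1 ≤ i → 2 * i ∸ 1 ≤ m → p at (2 * i ∸ 1) ≤ i) ×
  (∀ i → 1 ≤ i → 2 * i ≤ m → p at (2 * i) ≤ p at (2 * i ∸ 1)) ×
  (∀ i → 1 ≤ i → 2 * i + 1 ≤ m → p at (2 * i) ≤ p at (2 * i + 1))

charge : {m : ℕ} → Vec ℕ m → ℕ
charge p = sum (map (_∸ 1) p)

sumOver : {m : ℕ} → List (Vec ℕ m) → (Vec ℕ m → ℕ) → Poly
sumOver l f = foldr (λ p acc → q^ (f p) +ₚ acc) 0ₚ l

{-# OPTIONS --safe #-}
-- Deleting the last entry j of a pistol p ∈ AP_{i+1,j} leaves a pistol v ∈ AP_{i,k}, where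
-- k = p(i), and ch(p) - j + 1 = (k - 1) + (ch(v) - k + 1). Conversely, for j in range,
-- appending j to any v ∈ AP_{i,k} gives a pistol exactly when k ≤ j (i+1 odd) or j ≤ k
-- (i+1 even). Splitting the sum over AP_{i+1,j} by the value of p(i) therefore yields
-- Σ_k q^{k-1} Σ_{AP_{i,k}}, with k over 1..j in odd rows and over j..⌈i/2⌉ in even rows:
-- the Seidel recurrence.
module Submission where

open import Defs
open import Data.Nat
  using (ℕ; zero; suc; _≤_; _<_; z<s; _+_; _*_; _∸_; ⌈_/2⌉; ⌊_/2⌋; z≤n; s≤s; s≤s⁻¹; _≟_; _≤?_)
open import Data.Nat.Properties
open import Data.Bool using (true; false; if_then_else_)
open import Data.Vec using (Vec; []; _∷_; _∷ʳ_; initLast)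
open import Data.Vec.Properties using (∷ʳ-injectiveˡ)
open import Data.List using (List; []; _∷_; map; filter)
open import Data.List.Membership.Propositional using (_∈_)
open import Data.List.Membership.Propositional.Properties using (∈-map⁺; ∈-map⁻; ∈-filter⁺; ∈-filter⁻)
open import Data.List.Relation.Unary.Any using (here; there)
open import Data.List.Relation.Unary.All using (_∷_)
open import Data.List.Relation.Unary.AllPairs using (_∷_)
open import Data.List.Relation.Unary.Unique.Propositional using (Unique)
import Data.List.Relation.Unary.Unique.Propositional.Properties as Unique
open import Data.Product using (_×_; _,_; proj₁; proj₂; ∃)
open import Data.Sum using (_⊎_; inj₁; inj₂; map₁)
open import Function using (_∘_)
open import Function.Bundles using (_⇔_; mk⇔; Equivalence)
open import Relation.Nullary using (¬_; yes; no; ¬?; contradiction; _×-dec_)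
open import Relation.Unary using (Decidable)
open import Relation.Binary.Bundles using (Setoid)
open import Relation.Binary.PropositionalEquality
  using (_≡_; refl; sym; trans; cong; cong₂; subst; subst₂; _→-setoid_; module ≡-Reasoning)
import Relation.Binary.Reasoning.Setoid as SetoidReasoning
open import Algebra.Properties.CommutativeSemigroup +-commutativeSemigroup using (x∙yz≈y∙xz)

open Equivalence using (to; from)

Poly-setoid : Setoid _ _
Poly-setoid = ℕ →-setoid ℕ

open Setoid Poly-setoid using ()
  renaming (refl to ≈ₚ-refl; sym to ≈ₚ-sym; trans to ≈ₚ-trans)

module ≈ₚ-Reasoning = SetoidReasoning Poly-setoid

+ₚ-cong : ∀ {P P′ Q Q′} → P ≈ₚ P′ → Q ≈ₚ Q′ → (P +ₚ Q) ≈ₚ (P′ +ₚ Q′)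
+ₚ-cong P≈P′ Q≈Q′ n = cong₂ _+_ (P≈P′ n) (Q≈Q′ n)

+ₚ-comm : ∀ P Q → (P +ₚ Q) ≈ₚ (Q +ₚ P)
+ₚ-comm P Q n = +-comm (P n) (Q n)

+ₚ-assoc : ∀ P Q R → ((P +ₚ Q) +ₚ R) ≈ₚ (P +ₚ (Q +ₚ R))
+ₚ-assoc P Q R n = +-assoc (P n) (Q n) (R n)

q^-cong : ∀ a {P Q} → P ≈ₚ Q → (q^ a · P) ≈ₚ (q^ a · Q)
q^-cong zero    P≈Q n       = P≈Q n
q^-cong (suc a) P≈Q zero    = refl
q^-cong (suc a) P≈Q (suc n) = q^-cong a P≈Q n

q^-distrib-+ₚ : ∀ a P Q → (q^ a · (P +ₚ Q)) ≈ₚ ((q^ a · P) +ₚ (q^ a · Q))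
q^-distrib-+ₚ zero    P Q n       = refl
q^-distrib-+ₚ (suc a) P Q zero    = refl
q^-distrib-+ₚ (suc a) P Q (suc n) = q^-distrib-+ₚ a P Q n

q^-zeroʳ : ∀ a → (q^ a · 0ₚ) ≈ₚ 0ₚ
q^-zeroʳ zero    n       = refl
q^-zeroʳ (suc a) zero    = refl
q^-zeroʳ (suc a) (suc n) = q^-zeroʳ a n

q^-+ : ∀ a b P → (q^ (a + b) · P) ≈ₚ (q^ a · (q^ b · P))
q^-+ zero    b P n       = refl
q^-+ (suc a) b P zero    = refl
q^-+ (suc a) b P (suc n) = q^-+ a b P n

intervalSum : (ℕ → Poly) → ℕ → ℕ → Poly
intervalSum term a zero    = 0ₚ
intervalSum term a (suc s) = term a +ₚ intervalSum term (suc a) s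

intervalSum-suc : ∀ term a s → intervalSum term a (suc s) ≈ₚ (intervalSum term a s +ₚ term (a + s))
intervalSum-suc term a zero n = trans (+-identityʳ _) (cong (λ b → term b n) (sym (+-identityʳ a)))
intervalSum-suc term a (suc s) = begin
  term a +ₚ intervalSum term (suc a) (suc s)
    ≈⟨ +ₚ-cong {term a} ≈ₚ-refl (intervalSum-suc term (suc a) s) ⟩
  term a +ₚ (intervalSum term (suc a) s +ₚ term (suc a + s))
    ≈⟨ ≈ₚ-sym (+ₚ-assoc (term a) (intervalSum term (suc a) s) (term (suc a + s))) ⟩
  intervalSum term a (suc s) +ₚ term (suc a + s)
    ≡⟨ cong (λ b → intervalSum term a (suc s) +ₚ term b) (sym (+-suc a s)) ⟩
  intervalSum term a (suc s) +ₚ term (a + suc s) ∎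
  where open ≈ₚ-Reasoning

weightedEntry : (ℕ → Poly) → ℕ → Poly
weightedEntry row k = q^ (k ∸ 1) · row k

evenRaw≈intervalSum : ∀ row j s → evenRaw row j s ≈ₚ intervalSum (weightedEntry row) j s
evenRaw≈intervalSum row j zero    = ≈ₚ-refl
evenRaw≈intervalSum row j (suc s) =
  ≈ₚ-trans (+ₚ-cong (evenRaw≈intervalSum row (suc j) s) ≈ₚ-refl)
           (+ₚ-comm (intervalSum (weightedEntry row) (suc j) s) (weightedEntry row j))

oddRaw≈intervalSum : ∀ row c → oddRaw row c ≈ₚ intervalSum (weightedEntry row) 1 c
oddRaw≈intervalSum row zero    = ≈ₚ-refl
oddRaw≈intervalSum row (suc c) =
  ≈ₚ-trans (+ₚ-cong (oddRaw≈intervalSum row c) ≈ₚ-refl)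
           (≈ₚ-sym (intervalSum-suc (weightedEntry row) 1 c))

module _ {m : ℕ} where

  sumOver-cong : ∀ (l : List (Vec ℕ m)) {f f′} → (∀ {p} → p ∈ l → f p ≡ f′ p) → sumOver l f ≡ sumOver l f′
  sumOver-cong []      f≡f′ = refl
  sumOver-cong (p ∷ l) f≡f′ = cong₂ (λ a S → q^ a +ₚ S) (f≡f′ (here refl)) (sumOver-cong l (f≡f′ ∘ there))

  sumOver-map : ∀ {k} (h : Vec ℕ k → Vec ℕ m) l f → sumOver (map h l) f ≡ sumOver l (f ∘ h)
  sumOver-map h []      f = refl
  sumOver-map h (p ∷ l) f = cong (q^ (f (h p)) +ₚ_) (sumOver-map h l f)

  sumOver-+ : ∀ (l : List (Vec ℕ m)) a f → sumOver l (λ p → a + f p) ≈ₚ (q^ a · sumOver l f)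
  sumOver-+ []      a f = ≈ₚ-sym (q^-zeroʳ a)
  sumOver-+ (p ∷ l) a f =
    ≈ₚ-trans (+ₚ-cong (q^-+ a (f p) 1ₚ) (sumOver-+ l a f))
             (≈ₚ-sym (q^-distrib-+ₚ a (q^ (f p)) (sumOver l f)))

  sumOver-filter : ∀ {Q : Vec ℕ m → Set} (Q? : Decidable Q) l f →
    sumOver l f ≈ₚ (sumOver (filter Q? l) f +ₚ sumOver (filter (¬? ∘ Q?) l) f)
  sumOver-filter Q? []      f n = refl
  sumOver-filter Q? (p ∷ l) f n with Q? p
  ... | yes _ = trans (cong (q^ (f p) n +_) (sumOver-filter Q? l f n))
                      (sym (+-assoc (q^ (f p) n) (sumOver (filter Q? l) f n) (sumOver (filter (¬? ∘ Q?) l) f n)))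
  ... | no  _ = trans (cong (q^ (f p) n +_) (sumOver-filter Q? l f n))
                      (x∙yz≈y∙xz (q^ (f p) n) (sumOver (filter Q? l) f n) (sumOver (filter (¬? ∘ Q?) l) f n))

record Enumerates {A : Set} (P : A → Set) (l : List A) : Set where
  constructor enumerates
  field
    membership : ∀ x → x ∈ l ⇔ P x
    unique     : Unique l

open Enumerates

module _ {A : Set} {P : A → Set} where

  enumerates-resp : ∀ {Q : A → Set} {l} → (∀ {x} → P x → Q x) → (∀ {x} → Q x → P x) →
    Enumerates P l → Enumerates Q l
  enumerates-resp P⇒Q Q⇒P e =
    enumerates (λ x → mk⇔ (P⇒Q ∘ to (membership e x)) (from (membership e x) ∘ Q⇒P)) (unique e)

  enumerates-filter : ∀ {Q : A → Set} {l} (Q? : Decidable Q) → Enumerates P l →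
    Enumerates (λ x → P x × Q x) (filter Q? l)
  enumerates-filter Q? e = enumerates
    (λ x → mk⇔ (λ x∈ → let x∈l , Qx = ∈-filter⁻ Q? x∈ in to (membership e x) x∈l , Qx)
               (λ (Px , Qx) → ∈-filter⁺ Q? (from (membership e x) Px) Qx))
    (Unique.filter⁺ Q? (unique e))

  enumerates-map⁻ : ∀ {B : Set} {f : B → A} {l} → (∀ {x y} → f x ≡ f y → x ≡ y) →
    Enumerates P (map f l) → Enumerates (P ∘ f) l
  enumerates-map⁻ {f = f} f-inj e = enumerates
    (λ x → mk⇔ (to (membership e (f x)) ∘ ∈-map⁺ f)
               (λ Pfx → let y , y∈l , fx≡fy = ∈-map⁻ f (from (membership e (f x)) Pfx)
                        in subst (_∈ _) (sym (f-inj fx≡fy)) y∈l))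
    (Unique.map⁻ (unique e))

  enumerates-empty : ∀ {l} → (∀ {x} → ¬ P x) → Enumerates P l → l ≡ []
  enumerates-empty {[]}    ¬P e = refl
  enumerates-empty {x ∷ l} ¬P e = contradiction (to (membership e x) (here refl)) ¬P

enumerates-singleton : ∀ {A : Set} {a : A} {l} → Enumerates (_≡ a) l → l ≡ a ∷ []
enumerates-singleton {a = a} {[]} e with from (membership e a) refl
... | ()
enumerates-singleton {l = x ∷ []} e = cong (_∷ []) (to (membership e x) (here refl))
enumerates-singleton {l = x ∷ y ∷ l} e with unique e
... | (x≢y ∷ _) ∷ _ =
  contradiction (trans (to (membership e x) (here refl)) (sym (to (membership e y) (there (here refl))))) x≢y

data Parity : ℕ → Set where
  even : ∀ t → Parity (2 * t)
  odd  : ∀ t → Parity (suc (2 * t))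

parity : ∀ n → Parity n
parity zero = even 0
parity (suc n) with parity n
... | even t = odd t
... | odd  t = subst Parity (*-suc 2 t) (even (suc t))

2*-injective : ∀ {a b} → 2 * a ≡ 2 * b → a ≡ b
2*-injective {a} {b} = *-cancelˡ-≡ a b 2

2*[1+n]∸1≡1+2*n : ∀ n → 2 * suc n ∸ 1 ≡ suc (2 * n)
2*[1+n]∸1≡1+2*n n = cong (_∸ 1) (*-suc 2 n)

n≤2*n : ∀ n → n ≤ 2 * n
n≤2*n n = m≤m+n n (n + 0)

⌈2*n/2⌉≡n : ∀ n → ⌈ 2 * n /2⌉ ≡ n
⌈2*n/2⌉≡n n = trans (cong (λ m → ⌈ n + m /2⌉) (+-identityʳ n)) (sym (n≡⌈n+n/2⌉ n))

⌈1+2*n/2⌉≡1+n : ∀ n → ⌈ suc (2 * n) /2⌉ ≡ suc n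
⌈1+2*n/2⌉≡1+n n = cong suc (trans (cong (λ m → ⌊ n + m /2⌋) (+-identityʳ n)) (sym (n≡⌊n+n/2⌋ n)))

isOdd-2*n : ∀ n → isOdd (2 * n) ≡ false
isOdd-2*n zero    = refl
isOdd-2*n (suc n) = trans (cong isOdd (*-suc 2 n)) (isOdd-2*n n)

isOdd-1+2*n : ∀ n → isOdd (suc (2 * n)) ≡ true
isOdd-1+2*n zero    = refl
isOdd-1+2*n (suc n) = trans (cong (isOdd ∘ suc) (*-suc 2 n)) (isOdd-1+2*n n)

at-∷ʳ : ∀ {m} (v : Vec ℕ m) x {k} → k ≤ m → (v ∷ʳ x) at k ≡ v at k
at-∷ʳ []      x {zero}        _         = refl
at-∷ʳ (y ∷ v) x {zero}        _         = refl
at-∷ʳ (y ∷ v) x {suc zero}    _         = refl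
at-∷ʳ (y ∷ v) x {suc (suc k)} (s≤s k≤m) = at-∷ʳ v x k≤m

at-∷ʳ-last : ∀ {m} (v : Vec ℕ m) x → (v ∷ʳ x) at suc m ≡ x
at-∷ʳ-last []      x = refl
at-∷ʳ-last (y ∷ v) x = at-∷ʳ-last v x

at∸1≤charge : ∀ {m} (v : Vec ℕ m) k → v at k ∸ 1 ≤ charge v
at∸1≤charge []      k             = z≤n
at∸1≤charge (y ∷ v) zero          = z≤n
at∸1≤charge (y ∷ v) (suc zero)    = m≤m+n (y ∸ 1) (charge v)
at∸1≤charge (y ∷ v) (suc (suc k)) = ≤-trans (at∸1≤charge v (suc k)) (m≤n+m (charge v) (y ∸ 1))

charge-∷ʳ : ∀ {m} (v : Vec ℕ m) x → charge (v ∷ʳ x) ≡ charge v + (x ∸ 1)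
charge-∷ʳ []      x = +-identityʳ (x ∸ 1)
charge-∷ʳ (y ∷ v) x = trans (cong (y ∸ 1 +_) (charge-∷ʳ v x)) (sym (+-assoc (y ∸ 1) (charge v) (x ∸ 1)))

∷ʳ-image : ∀ {n x} (l : List (Vec ℕ (suc n))) → (∀ {p} → p ∈ l → p at suc n ≡ x) →
  ∃ λ l₀ → l ≡ map (_∷ʳ x) l₀
∷ʳ-image []      _     = [] , refl
∷ʳ-image {x = x} (p ∷ l) last≡ with initLast p | ∷ʳ-image l (last≡ ∘ there)
... | v , y , refl | l₀ , refl =
  v ∷ l₀ , cong (λ z → (v ∷ʳ z) ∷ map (_∷ʳ x) l₀) (trans (sym (at-∷ʳ-last v y)) (last≡ (here refl)))

AP[_,_] : (n j : ℕ) → Vec ℕ n → Set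
AP[ n , j ] p = AlternatingPistol n p × p at n ≡ j

ap-at≥1 : ∀ {m} (p : Vec ℕ m) → AlternatingPistol m p → ∀ {k} → 1 ≤ k → k ≤ m → 1 ≤ p at k
ap-at≥1 p (range , _) 1≤k k≤m = proj₁ (range _ 1≤k k≤m)

ap-at≤⌈/2⌉ : ∀ {m} (p : Vec ℕ m) → AlternatingPistol m p → ∀ {k} → 1 ≤ k → k ≤ m → p at k ≤ ⌈ k /2⌉
ap-at≤⌈/2⌉ {m} p (_ , even≤ , odd≤ , _) {k} 1≤k k≤m with parity k
... | even zero    = contradiction 1≤k λ ()
... | even (suc t) = subst (p at (2 * suc t) ≤_) (sym (⌈2*n/2⌉≡n (suc t))) (even≤ (suc t) (s≤s z≤n) k≤m)
... | odd t        =
  subst₂ _≤_ (cong (p at_) (2*[1+n]∸1≡1+2*n t)) (sym (⌈1+2*n/2⌉≡1+n t))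
    (odd≤ (suc t) (s≤s z≤n) (subst (_≤ m) (sym (2*[1+n]∸1≡1+2*n t)) k≤m))

ap-descent : ∀ {t} (p : Vec ℕ (suc (suc (2 * t)))) → AlternatingPistol _ p →
  p at suc (suc (2 * t)) ≤ p at suc (2 * t)
ap-descent {t} p (_ , _ , _ , descent , _) =
  subst₂ _≤_ (cong (p at_) (*-suc 2 t)) (cong (p at_) (2*[1+n]∸1≡1+2*n t))
    (descent (suc t) (s≤s z≤n) (≤-reflexive (*-suc 2 t)))

ap-ascent : ∀ {t} (p : Vec ℕ (suc (suc (suc (2 * t))))) → AlternatingPistol _ p →
  p at suc (suc (2 * t)) ≤ p at suc (suc (suc (2 * t)))
ap-ascent {t} p (_ , _ , _ , _ , ascent) =
  subst₂ _≤_ (cong (p at_) (*-suc 2 t)) (cong (p at_) index)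
    (ascent (suc t) (s≤s z≤n) (≤-reflexive index))
  where
  index : 2 * suc t + 1 ≡ suc (suc (suc (2 * t)))
  index = trans (+-comm (2 * suc t) 1) (cong suc (*-suc 2 t))

ap-[] : AlternatingPistol 0 []
ap-[] = (λ { (suc _) _ () }) , (λ _ _ _ → z≤n) , (λ _ _ _ → z≤n) , (λ _ _ _ → z≤n) , (λ _ _ _ → z≤n)

ap-∷ʳ⁻ : ∀ {m} (v : Vec ℕ m) x → AlternatingPistol (suc m) (v ∷ʳ x) → AlternatingPistol m v
ap-∷ʳ⁻ {m} v x ap@(_ , even≤ , odd≤ , descent , ascent) =
  (λ k 1≤k k≤m →
     subst (1 ≤_) (old k≤m) (ap-at≥1 (v ∷ʳ x) ap 1≤k (weaken k≤m)) ,
     subst (_≤ m) (old k≤m) (≤-trans (ap-at≤⌈/2⌉ (v ∷ʳ x) ap 1≤k (weaken k≤m)) (≤-trans (⌈n/2⌉≤n k) k≤m))) ,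
  (λ i 1≤i 2i≤m → subst (_≤ i) (old 2i≤m) (even≤ i 1≤i (weaken 2i≤m))) ,
  (λ i 1≤i 2i∸1≤m → subst (_≤ i) (old 2i∸1≤m) (odd≤ i 1≤i (weaken 2i∸1≤m))) ,
  (λ i 1≤i 2i≤m →
     subst₂ _≤_ (old 2i≤m) (old (≤-trans (m∸n≤m (2 * i) 1) 2i≤m)) (descent i 1≤i (weaken 2i≤m))) ,
  (λ i 1≤i 2i+1≤m →
     subst₂ _≤_ (old (≤-trans (m≤m+n (2 * i) 1) 2i+1≤m)) (old 2i+1≤m) (ascent i 1≤i (weaken 2i+1≤m)))
  where
  weaken : ∀ {a b} → a ≤ b → a ≤ suc b
  weaken = m≤n⇒m≤1+n
  old : ∀ {k} → k ≤ m → (v ∷ʳ x) at k ≡ v at k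
  old = at-∷ʳ v x

ap-∷ʳ⁺ : ∀ {m} (v : Vec ℕ m) x → AlternatingPistol m v → 1 ≤ x → x ≤ suc m →
  (∀ i → 2 * i ≡ suc m → x ≤ i × x ≤ v at (2 * i ∸ 1)) →
  (∀ i → 2 * i ∸ 1 ≡ suc m → x ≤ i) →
  (∀ i → 2 * i + 1 ≡ suc m → v at (2 * i) ≤ x) →
  AlternatingPistol (suc m) (v ∷ʳ x)
ap-∷ʳ⁺ {m} v x (range , even≤ , odd≤ , descent , ascent) 1≤x x≤1+m x-at-even x-at-odd x-after-even =
  range′ , even≤′ , odd≤′ , descent′ , ascent′
  where
  old : ∀ {k} → k ≤ m → (v ∷ʳ x) at k ≡ v at k
  old = at-∷ʳ v x

  new : ∀ {k} → k ≡ suc m → (v ∷ʳ x) at k ≡ x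
  new refl = at-∷ʳ-last v x

  split : ∀ {k} → k ≤ suc m → k ≤ m ⊎ k ≡ suc m
  split k≤1+m = map₁ s≤s⁻¹ (m≤n⇒m<n∨m≡n k≤1+m)

  range′ : ∀ k → 1 ≤ k → k ≤ suc m → (1 ≤ (v ∷ʳ x) at k) × ((v ∷ʳ x) at k ≤ suc m)
  range′ k 1≤k k≤1+m with split k≤1+m
  ... | inj₁ k≤m = let 1≤vk , vk≤m = range k 1≤k k≤m in
                   subst (1 ≤_) (sym (old k≤m)) 1≤vk , subst (_≤ suc m) (sym (old k≤m)) (m≤n⇒m≤1+n vk≤m)
  ... | inj₂ k≡  = subst (1 ≤_) (sym (new k≡)) 1≤x , subst (_≤ suc m) (sym (new k≡)) x≤1+m

  even≤′ : ∀ i → 1 ≤ i → 2 * i ≤ suc m → (v ∷ʳ x) at (2 * i) ≤ i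
  even≤′ i 1≤i 2i≤1+m with split 2i≤1+m
  ... | inj₁ 2i≤m = subst (_≤ i) (sym (old 2i≤m)) (even≤ i 1≤i 2i≤m)
  ... | inj₂ 2i≡  = subst (_≤ i) (sym (new 2i≡)) (proj₁ (x-at-even i 2i≡))

  odd≤′ : ∀ i → 1 ≤ i → 2 * i ∸ 1 ≤ suc m → (v ∷ʳ x) at (2 * i ∸ 1) ≤ i
  odd≤′ i 1≤i 2i∸1≤1+m with split 2i∸1≤1+m
  ... | inj₁ 2i∸1≤m = subst (_≤ i) (sym (old 2i∸1≤m)) (odd≤ i 1≤i 2i∸1≤m)
  ... | inj₂ 2i∸1≡  = subst (_≤ i) (sym (new 2i∸1≡)) (x-at-odd i 2i∸1≡)

  descent′ : ∀ i → 1 ≤ i → 2 * i ≤ suc m → (v ∷ʳ x) at (2 * i) ≤ (v ∷ʳ x) at (2 * i ∸ 1)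
  descent′ i 1≤i 2i≤1+m with split 2i≤1+m
  ... | inj₁ 2i≤m = subst₂ _≤_ (sym (old 2i≤m)) (sym (old (≤-trans (m∸n≤m (2 * i) 1) 2i≤m))) (descent i 1≤i 2i≤m)
  ... | inj₂ 2i≡  = subst₂ _≤_ (sym (new 2i≡)) (sym (old (≤-reflexive (cong (_∸ 1) 2i≡))))
                      (proj₂ (x-at-even i 2i≡))

  ascent′ : ∀ i → 1 ≤ i → 2 * i + 1 ≤ suc m → (v ∷ʳ x) at (2 * i) ≤ (v ∷ʳ x) at (2 * i + 1)
  ascent′ i 1≤i 2i+1≤1+m with split 2i+1≤1+m
  ... | inj₁ 2i+1≤m = subst₂ _≤_ (sym (old (≤-trans (m≤m+n (2 * i) 1) 2i+1≤m))) (sym (old 2i+1≤m))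
                        (ascent i 1≤i 2i+1≤m)
  ... | inj₂ 2i+1≡  = subst₂ _≤_ (sym (old (≤-reflexive (suc-injective (trans (+-comm 1 (2 * i)) 2i+1≡)))))
                        (sym (new 2i+1≡)) (x-after-even i 2i+1≡)

ap-∷ʳ⁺-even : ∀ {m t} (v : Vec ℕ m) x → m ≡ suc (2 * t) → AlternatingPistol m v →
  1 ≤ x → x ≤ suc t → x ≤ v at m → AlternatingPistol (suc m) (v ∷ʳ x)
ap-∷ʳ⁺-even {t = t} v x refl ap 1≤x x≤1+t x≤vm =
  ap-∷ʳ⁺ v x ap 1≤x (≤-trans x≤1+t (s≤s (≤-trans (n≤2*n t) (n≤1+n _)))) x-at-even x-at-odd x-after-even
  where
  x-at-even : ∀ i → 2 * i ≡ suc (suc (2 * t)) → x ≤ i × x ≤ v at (2 * i ∸ 1)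
  x-at-even i 2i≡ with 2*-injective {i} {suc t} (trans 2i≡ (sym (*-suc 2 t)))
  ... | refl = x≤1+t , subst (λ k → x ≤ v at k) (sym (2*[1+n]∸1≡1+2*n t)) x≤vm
  x-at-odd : ∀ i → 2 * i ∸ 1 ≡ suc (suc (2 * t)) → x ≤ i
  x-at-odd (suc i) 2i∸1≡ = contradiction (suc-injective (trans (sym (2*[1+n]∸1≡1+2*n i)) 2i∸1≡)) (even≢odd i t)
  x-after-even : ∀ i → 2 * i + 1 ≡ suc (suc (2 * t)) → v at (2 * i) ≤ x
  x-after-even i 2i+1≡ = contradiction (suc-injective (trans (+-comm 1 (2 * i)) 2i+1≡)) (even≢odd i t)

-- For t = 0 the condition v at 0 ≤ x holds because _at_ returns 0 at position 0, so this
-- also produces the pistols of length 1.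
ap-∷ʳ⁺-odd : ∀ {m t} (v : Vec ℕ m) x → m ≡ 2 * t → AlternatingPistol m v →
  1 ≤ x → x ≤ suc t → v at m ≤ x → AlternatingPistol (suc m) (v ∷ʳ x)
ap-∷ʳ⁺-odd {t = t} v x refl ap 1≤x x≤1+t vm≤x =
  ap-∷ʳ⁺ v x ap 1≤x (≤-trans x≤1+t (s≤s (n≤2*n t))) x-at-even x-at-odd x-after-even
  where
  x-at-even : ∀ i → 2 * i ≡ suc (2 * t) → x ≤ i × x ≤ v at (2 * i ∸ 1)
  x-at-even i 2i≡ = contradiction 2i≡ (even≢odd i t)
  x-at-odd : ∀ i → 2 * i ∸ 1 ≡ suc (2 * t) → x ≤ i
  x-at-odd (suc i) 2i∸1≡ with 2*-injective {i} {t} (suc-injective (trans (sym (2*[1+n]∸1≡1+2*n i)) 2i∸1≡))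
  ... | refl = x≤1+t
  x-after-even : ∀ i → 2 * i + 1 ≡ suc (2 * t) → v at (2 * i) ≤ x
  x-after-even i 2i+1≡ with 2*-injective {i} {t} (suc-injective (trans (+-comm 1 (2 * i)) 2i+1≡))
  ... | refl = vm≤x

-- The rows of the q-Seidel triangle as interval sums

inRange-inside : ∀ m {j} P → 1 ≤ j → j ≤ ⌈ m /2⌉ → inRange m j P ≡ P
inRange-inside m {suc j} P _ j≤ with suc j ≤? ⌈ m /2⌉
... | yes _  = refl
... | no  j≰ = contradiction j≤ j≰

inRange-outside : ∀ m {j} P → ¬ (1 ≤ j × j ≤ ⌈ m /2⌉) → inRange m j P ≡ 0ₚ
inRange-outside m {zero}  P _   = refl
inRange-outside m {suc j} P out with suc j ≤? ⌈ m /2⌉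
... | yes j≤ = contradiction (s≤s z≤n , j≤) out
... | no  _  = refl

g-outside : ∀ n {j} → ¬ (1 ≤ j × j ≤ ⌈ n /2⌉) → g n j ≡ 0ₚ
g-outside zero          _   = refl
g-outside (suc zero)    out = inRange-outside 1 1ₚ out
g-outside (suc (suc m)) out = inRange-outside (suc (suc m)) _ out

g-even : ∀ t {j} → 1 ≤ j → j ≤ suc t →
  g (suc (suc (2 * t))) j ≈ₚ intervalSum (weightedEntry (g (suc (2 * t)))) j (suc (suc t) ∸ j)
g-even t {j} 1≤j j≤1+t = begin
  g (suc (suc (2 * t))) j
    ≡⟨ inRange-inside (suc (suc (2 * t))) _ 1≤j (subst (j ≤_) (cong suc (sym (⌈2*n/2⌉≡n t))) j≤1+t) ⟩
  (if isOdd (2 * t) then oddRaw row j else evenRaw row j (suc (suc ⌈ 2 * t /2⌉) ∸ j))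
    ≡⟨ cong (λ b → if b then oddRaw row j else evenRaw row j (suc (suc ⌈ 2 * t /2⌉) ∸ j)) (isOdd-2*n t) ⟩
  evenRaw row j (suc (suc ⌈ 2 * t /2⌉) ∸ j)
    ≡⟨ cong (λ c → evenRaw row j (suc (suc c) ∸ j)) (⌈2*n/2⌉≡n t) ⟩
  evenRaw row j (suc (suc t) ∸ j)
    ≈⟨ evenRaw≈intervalSum row j (suc (suc t) ∸ j) ⟩
  intervalSum (weightedEntry row) j (suc (suc t) ∸ j) ∎
  where
  open ≈ₚ-Reasoning
  row : ℕ → Poly
  row = g (suc (2 * t))

g-odd : ∀ t {j} → 1 ≤ j → j ≤ suc (suc t) →
  g (suc (suc (suc (2 * t)))) j ≈ₚ intervalSum (weightedEntry (g (suc (suc (2 * t))))) 1 j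
g-odd t {j} 1≤j j≤2+t = begin
  g (suc (suc (suc (2 * t)))) j
    ≡⟨ inRange-inside (suc (suc (suc (2 * t)))) _ 1≤j (subst (j ≤_) (cong suc (sym (⌈1+2*n/2⌉≡1+n t))) j≤2+t) ⟩
  (if isOdd (suc (2 * t)) then oddRaw row j else evenRaw row j (suc ⌈ suc (suc (suc (2 * t))) /2⌉ ∸ j))
    ≡⟨ cong (λ b → if b then oddRaw row j else evenRaw row j (suc ⌈ suc (suc (suc (2 * t))) /2⌉ ∸ j)) (isOdd-1+2*n t) ⟩
  oddRaw row j
    ≈⟨ oddRaw≈intervalSum row j ⟩
  intervalSum (weightedEntry row) 1 j ∎
  where
  open ≈ₚ-Reasoning
  row : ℕ → Poly
  row = g (suc (suc (2 * t)))

-- Summing over pistols by their second-to-last entry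

weight : ∀ {n} → ℕ → Vec ℕ n → ℕ
weight j p = charge p + 1 ∸ j

SeidelEntry : ℕ → ℕ → Set
SeidelEntry n j = ∀ l → Enumerates AP[ n , j ] l → g n j ≈ₚ sumOver l (weight j)

SeidelRow : ℕ → Set
SeidelRow n = ∀ j → SeidelEntry n j

sumOver-fibres : ∀ {n} {P : Vec ℕ n → Set} (f w : Vec ℕ n → ℕ) term a s →
  (∀ p → P p → a ≤ f p × f p < a + s) →
  (∀ {k} → a ≤ k → k < a + s → ∀ {l} → Enumerates (λ p → P p × f p ≡ k) l → sumOver l w ≈ₚ term k) →
  ∀ {l} → Enumerates P l → sumOver l w ≈ₚ intervalSum term a s
sumOver-fibres f w term a zero bounds _ e
  rewrite enumerates-empty (λ Pp → let a≤fp , fp<a+0 = bounds _ Pp in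
                                   <⇒≱ (subst (_ <_) (+-identityʳ a) fp<a+0) a≤fp) e = ≈ₚ-refl
sumOver-fibres {P = P} f w term a (suc s) bounds fibre {l} e = begin
  sumOver l w
    ≈⟨ sumOver-filter (λ p → f p ≟ a) l w ⟩
  sumOver (filter (λ p → f p ≟ a) l) w +ₚ sumOver (filter (λ p → ¬? (f p ≟ a)) l) w
    ≈⟨ +ₚ-cong (fibre ≤-refl (m<m+n a z<s) (enumerates-filter (λ p → f p ≟ a) e))
               (sumOver-fibres f w term (suc a) s bounds′ fibre′ (enumerates-filter (λ p → ¬? (f p ≟ a)) e)) ⟩
  term a +ₚ intervalSum term (suc a) s ∎
  where
  open ≈ₚ-Reasoning
  bounds′ : ∀ p → P p × ¬ f p ≡ a → suc a ≤ f p × f p < suc a + s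
  bounds′ p (Pp , fp≢a) = let a≤fp , fp< = bounds p Pp in
    ≤∧≢⇒< a≤fp (fp≢a ∘ sym) , subst (f p <_) (+-suc a s) fp<
  fibre′ : ∀ {k} → suc a ≤ k → k < suc a + s → ∀ {l} →
    Enumerates (λ p → (P p × ¬ f p ≡ a) × f p ≡ k) l → sumOver l w ≈ₚ term k
  fibre′ {k} a<k k< = fibre (<⇒≤ a<k) (subst (k <_) (sym (+-suc a s)) k<)
    ∘ enumerates-resp (λ ((Pp , _) , fp≡k) → Pp , fp≡k)
                      (λ (Pp , fp≡k) → (Pp , λ fp≡a → <⇒≢ a<k (trans (sym fp≡a) fp≡k)) , fp≡k)

weight-∷ʳ : ∀ {n} (v : Vec ℕ n) j → weight (suc j) (v ∷ʳ suc j) ≡ charge v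
weight-∷ʳ v j = begin
  charge (v ∷ʳ suc j) + 1 ∸ suc j ≡⟨ cong (λ c → c + 1 ∸ suc j) (charge-∷ʳ v (suc j)) ⟩
  charge v + j + 1 ∸ suc j        ≡⟨ cong (_∸ suc j) (+-comm (charge v + j) 1) ⟩
  charge v + j ∸ j                ≡⟨ m+n∸n≡m (charge v) j ⟩
  charge v                        ∎
  where open ≡-Reasoning

charge≡shift+weight : ∀ {n} (v : Vec ℕ n) k → k ≤ charge v → charge v ≡ k + weight (suc k) v
charge≡shift+weight v k k≤charge = begin
  charge v                         ≡⟨ sym (m+[n∸m]≡n k≤charge) ⟩
  k + (charge v ∸ k)               ≡⟨ cong (λ c → k + (c ∸ suc k)) (+-comm 1 (charge v)) ⟩
  k + (charge v + 1 ∸ suc k)       ∎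
  where open ≡-Reasoning

sumOver-fibre : ∀ {n j k} → SeidelRow n → 1 ≤ j → 1 ≤ k →
  (∀ v → AP[ n , k ] v → AlternatingPistol (suc n) (v ∷ʳ j)) →
  ∀ {l} → Enumerates (λ p → AP[ suc n , j ] p × p at n ≡ k) l →
  sumOver l (weight j) ≈ₚ weightedEntry (g n) k
sumOver-fibre {n} {suc j} {suc k} row _ _ extend {l} e
  with ∷ʳ-image l (λ p∈l → proj₂ (proj₁ (to (membership e _) p∈l)))
... | l₀ , refl = begin
  sumOver (map (_∷ʳ suc j) l₀) (weight (suc j))    ≡⟨ sumOver-map (_∷ʳ suc j) l₀ (weight (suc j)) ⟩
  sumOver l₀ (λ v → weight (suc j) (v ∷ʳ suc j))   ≡⟨ sumOver-cong l₀ shift ⟩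
  sumOver l₀ (λ v → k + weight (suc k) v)          ≈⟨ sumOver-+ l₀ k (weight (suc k)) ⟩
  q^ k · sumOver l₀ (weight (suc k))               ≈⟨ q^-cong k (≈ₚ-sym (row (suc k) l₀ e₀)) ⟩
  q^ k · g n (suc k)                               ∎
  where
  open ≈ₚ-Reasoning
  e₀ : Enumerates AP[ n , suc k ] l₀
  e₀ = enumerates-resp (λ {v} ((ap , _) , vn≡) → ap-∷ʳ⁻ v (suc j) ap , trans (sym (at-∷ʳ v (suc j) ≤-refl)) vn≡)
                       (λ {v} (ap , vn≡) → (extend v (ap , vn≡) , at-∷ʳ-last v (suc j)) ,
                                            trans (at-∷ʳ v (suc j) ≤-refl) vn≡)
                       (enumerates-map⁻ (∷ʳ-injectiveˡ _ _) e)
  shift : ∀ {v} → v ∈ l₀ → weight (suc j) (v ∷ʳ suc j) ≡ k + weight (suc k) v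
  shift {v} v∈l₀ = trans (weight-∷ʳ v j) (charge≡shift+weight v k
    (subst (λ c → c ∸ 1 ≤ charge v) (proj₂ (to (membership e₀ v) v∈l₀)) (at∸1≤charge v n)))

seidelEntry-outside : ∀ {m j} → ¬ (1 ≤ j × j ≤ ⌈ suc m /2⌉) → SeidelEntry (suc m) j
seidelEntry-outside {m} out l e
  rewrite g-outside (suc m) out
        | enumerates-empty (λ {p} (ap , pn≡j) →
            out (subst (1 ≤_) pn≡j (ap-at≥1 p ap (s≤s z≤n) ≤-refl) ,
                 subst (_≤ ⌈ suc m /2⌉) pn≡j (ap-at≤⌈/2⌉ p ap (s≤s z≤n) ≤-refl))) e
  = ≈ₚ-refl

seidelRow-fromInside : ∀ {m} → (∀ {j} → 1 ≤ j → j ≤ ⌈ suc m /2⌉ → SeidelEntry (suc m) j) → SeidelRow (suc m)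
seidelRow-fromInside {m} inside j with 1 ≤? j ×-dec j ≤? ⌈ suc m /2⌉
... | yes (1≤j , j≤) = inside 1≤j j≤
... | no  out        = seidelEntry-outside out

enumerates-AP[1,1] : ∀ {l} → Enumerates AP[ 1 , 1 ] l → l ≡ (1 ∷ []) ∷ []
enumerates-AP[1,1] = enumerates-singleton ∘ enumerates-resp only-[1] is-pistol
  where
  only-[1] : ∀ {p} → AP[ 1 , 1 ] p → p ≡ 1 ∷ []
  only-[1] {x ∷ []} (_ , x≡1) = cong (_∷ []) x≡1
  is-pistol : ∀ {p} → p ≡ 1 ∷ [] → AP[ 1 , 1 ] p
  is-pistol refl = ap-∷ʳ⁺-odd {t = 0} [] 1 refl ap-[] (s≤s z≤n) (s≤s z≤n) z≤n , refl

seidelEntry-one : ∀ {j} → 1 ≤ j → j ≤ 1 → SeidelEntry 1 j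
seidelEntry-one (s≤s z≤n) (s≤s z≤n) l e rewrite enumerates-AP[1,1] e = λ n → sym (+-identityʳ _)

seidelEntry-even : ∀ t → SeidelRow (suc (2 * t)) → ∀ {j} → 1 ≤ j → j ≤ suc t →
  SeidelEntry (suc (suc (2 * t))) j
seidelEntry-even t row {j} 1≤j j≤1+t l e =
  ≈ₚ-trans (g-even t 1≤j j≤1+t)
    (≈ₚ-sym (sumOver-fibres {P = AP[ suc n , j ]} (_at n) (weight j) (weightedEntry (g n))
                            j (suc (suc t) ∸ j) bounds fibre e))
  where
  n : ℕ
  n = suc (2 * t)
  bounds : ∀ p → AP[ suc n , j ] p → j ≤ p at n × p at n < j + (suc (suc t) ∸ j)
  bounds p (ap , p-last≡j) =
    subst (_≤ p at n) p-last≡j (ap-descent {t} p ap) ,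
    subst (p at n <_) (sym (m+[n∸m]≡n (m≤n⇒m≤1+n j≤1+t)))
      (s≤s (subst (p at n ≤_) (⌈1+2*n/2⌉≡1+n t) (ap-at≤⌈/2⌉ p ap (s≤s z≤n) (n≤1+n n))))
  fibre : ∀ {k} → j ≤ k → k < j + (suc (suc t) ∸ j) → ∀ {l} →
    Enumerates (λ p → AP[ suc n , j ] p × p at n ≡ k) l → sumOver l (weight j) ≈ₚ weightedEntry (g n) k
  fibre j≤k _ = sumOver-fibre row 1≤j (≤-trans 1≤j j≤k)
    (λ v (ap , vn≡k) → ap-∷ʳ⁺-even v j refl ap 1≤j j≤1+t (subst (j ≤_) (sym vn≡k) j≤k))

seidelEntry-odd : ∀ t → SeidelRow (suc (suc (2 * t))) → ∀ {j} → 1 ≤ j → j ≤ suc (suc t) →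
  SeidelEntry (suc (suc (suc (2 * t)))) j
seidelEntry-odd t row {j} 1≤j j≤2+t l e =
  ≈ₚ-trans (g-odd t 1≤j j≤2+t)
    (≈ₚ-sym (sumOver-fibres {P = AP[ suc n , j ]} (_at n) (weight j) (weightedEntry (g n)) 1 j bounds fibre e))
  where
  n : ℕ
  n = suc (suc (2 * t))
  bounds : ∀ p → AP[ suc n , j ] p → 1 ≤ p at n × p at n < 1 + j
  bounds p (ap , p-last≡j) =
    ap-at≥1 p ap (s≤s z≤n) (n≤1+n n) , s≤s (subst (p at n ≤_) p-last≡j (ap-ascent {t} p ap))
  fibre : ∀ {k} → 1 ≤ k → k < 1 + j → ∀ {l} →
    Enumerates (λ p → AP[ suc n , j ] p × p at n ≡ k) l → sumOver l (weight j) ≈ₚ weightedEntry (g n) k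
  fibre 1≤k k<1+j = sumOver-fibre row 1≤j 1≤k
    (λ v (ap , vn≡k) → ap-∷ʳ⁺-odd {t = suc t} v j (sym (*-suc 2 t)) ap 1≤j j≤2+t
                                  (subst (_≤ j) (sym vn≡k) (s≤s⁻¹ k<1+j)))

seidelRow-step : ∀ m → SeidelRow (suc m) → SeidelRow (suc (suc m))
seidelRow-step m row with parity m
... | even t = seidelRow-fromInside λ {j} 1≤j j≤ →
  seidelEntry-even t row 1≤j (subst (j ≤_) (cong suc (⌈2*n/2⌉≡n t)) j≤)
... | odd t = seidelRow-fromInside λ {j} 1≤j j≤ →
  seidelEntry-odd t row 1≤j (subst (j ≤_) (cong suc (⌈1+2*n/2⌉≡1+n t)) j≤)

seidelRow : ∀ m → SeidelRow (suc m)
seidelRow zero    = seidelRow-fromInside seidelEntry-one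
seidelRow (suc m) = seidelRow-step m (seidelRow m)

proposition1 : (i j : ℕ) → 1 ≤ i → 1 ≤ j → j ≤ ⌈ i /2⌉ →
    (l : List (Vec ℕ i)) →
    (∀ p → (p ∈ l) ⇔ (AlternatingPistol i p × (p at i ≡ j))) → Unique l →
    g i j ≈ₚ sumOver l (λ p → charge p + 1 ∸ j)
proposition1 (suc m) j _ _ _ l membership unique = seidelRow m j l (enumerates membership unique)
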